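{- Let $n,s$ be positive integers and $\alpha=(1+\sqrt5)/2$. Then \[\big|(F_n\sqrt5)^s-\alpha^{ns}\big|<2^s\alpha^{n(s-2)}.\] Moreover, if $n>\log_\alpha(s)$, then \[\big|(F_n\sqrt5)^s-\alpha^{ns}\big|<2s\,\alpha^{n(s-2)}.\]
   Context: The Fibonacci sequence is defined by $F_0=0$, $F_1=1$ and $F_{n+2}=F_{n+1}+F_n$ for $n\ge 0$. -}

module Defs where

open import Data.Bool using (Bool; true; false; not; _∧_; _∨_; if_then_else_; T)
open import Data.Nat as ℕ using (ℕ; zero; suc)
open import Data.Integer as ℤ using (ℤ; +_; -[1+_]; _≤ᵇ_)

fib : ℕ → ℕ
fib zero = zero
fib (suc zero) = suc zero
fib (suc (suc n)) = fib (suc n) ℕ.+ fib n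

-- The ring ℤ[α] ⊂ ℝ, α = (1+√5)/2, elements  a + b·α  (a b : ℤ), α² = α + 1.
-- All quantities in the statement lie in this ring (α is a unit: α⁻¹ = α - 1,
-- √5 = 2α - 1), and it carries the order induced from ℝ, defined below exactly.
record ℤα : Set where
  constructor _+_·α
  field
    re : ℤ
    im : ℤ
open ℤα public

infixl 6 _⊕_ _⊖_
infixl 7 _⊗_

_⊕_ : ℤα → ℤα → ℤα
(a + b ·α) ⊕ (c + d ·α) = (a ℤ.+ c) + (b ℤ.+ d) ·α

⊝_ : ℤα → ℤα
⊝ (a + b ·α) = (ℤ.- a) + (ℤ.- b) ·α

_⊖_ : ℤα → ℤα → ℤα
x ⊖ y = x ⊕ (⊝ y)

-- (a + bα)(c + dα) = ac + bd + (ad + bc + bd)α   since α² = α + 1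
_⊗_ : ℤα → ℤα → ℤα
(a + b ·α) ⊗ (c + d ·α) = (a ℤ.* c ℤ.+ b ℤ.* d) + (a ℤ.* d ℤ.+ b ℤ.* c ℤ.+ b ℤ.* d) ·α

fromℕ : ℕ → ℤα
fromℕ n = (+ n) + (+ 0) ·α

𝟙 : ℤα
𝟙 = fromℕ 1

α : ℤα
α = (+ 0) + (+ 1) ·α

α⁻¹ : ℤα
α⁻¹ = -[1+ 0 ] + (+ 1) ·α

√5 : ℤα
√5 = -[1+ 0 ] + (+ 2) ·α

_^_ : ℤα → ℕ → ℤα
x ^ zero = 𝟙
x ^ suc k = x ⊗ (x ^ k)

α^ : ℤ → ℤα
α^ (+ k) = α ^ k
α^ -[1+ k ] = α⁻¹ ^ suc k

-- Order (as real numbers).  a + bα = (p + q√5)/2 with p = 2a + b, q = b.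
infix 4 _<ᵇᶻ_
_<ᵇᶻ_ : ℤ → ℤ → Bool
i <ᵇᶻ j = not (j ≤ᵇ i)

posPQ : ℤ → ℤ → Bool
posPQ p q =
     ((ℤ.0ℤ ≤ᵇ p) ∧ (ℤ.0ℤ ≤ᵇ q) ∧ ((ℤ.0ℤ <ᵇᶻ p) ∨ (ℤ.0ℤ <ᵇᶻ q)))
  ∨ ((ℤ.0ℤ <ᵇᶻ p) ∧ (q <ᵇᶻ ℤ.0ℤ) ∧ ((+ 5 ℤ.* (q ℤ.* q)) <ᵇᶻ (p ℤ.* p)))
  ∨ ((p <ᵇᶻ ℤ.0ℤ) ∧ (ℤ.0ℤ <ᵇᶻ q) ∧ ((p ℤ.* p) <ᵇᶻ (+ 5 ℤ.* (q ℤ.* q))))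

pos? : ℤα → Bool
pos? (a + b ·α) = posPQ (+ 2 ℤ.* a ℤ.+ b) b

infix 4 _<_
_<_ : ℤα → ℤα → Set
x < y = T (pos? (y ⊖ x))

∣_∣ : ℤα → ℤα
∣ x ∣ = if pos? (⊝ x) then ⊝ x else x

-- Write A = α^n, B = β^n with β = 1 − α, and u = F_n √5. Binet's formula gives u = A − B, and AB = (−1)^n.
-- From u^(s+1) − A^(s+1) = u (u^s − A^s) − B A^s, the scaled errors E_s = A² (u^s − A^s) satisfy
-- E_(s+1) = u E_s − (−1)^n A^(s+1). Hence |E_s| ≤ t A^s yields |E_(s+1)| ≤ (t + 1 + d) A^(s+1) whenever
-- t ≤ d A², the slack being A^s (dA + tB) with A (dA + tB) = dA² ± t. Taking d = t gives t_s = 2^s − 1;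
-- if s < A then 2k − 1 ≤ s² < A² for k ≤ s, and d = 1 gives t_k = 2k − 1. Since A^s > 0 the bounds become
-- strict with one more unit, and dividing by A² = α^(2n) gives the theorem.
--
-- Everything happens in ℤ[α]: an element counts as positive when some multiple x α^m has natural coordinates,
-- not both zero. This notion is closed under sums and products, and it agrees with pos?: multiplication by
-- α⁻¹ preserves pos?, and a Euclid-like descent shows that every element is zero, positive or negative.

module Submission where

open import Defs
open import Algebra.Bundles using (CommutativeRing)
open import Algebra.Structures using (IsCommutativeRing)
open import Algebra.Consequences.Propositional
  using (comm∧idˡ⇒id; comm∧invˡ⇒inv; comm∧distrˡ⇒distrʳ)
open import Data.Bool using (true; false; not; _∧_; T)
open import Data.Bool.Properties using (T-∧; T-∨)
open import Data.Maybe using (Maybe; just; nothing)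
open import Data.Nat as ℕ using (ℕ; zero; suc; NonZero)
import Data.Nat.Properties as ℕₚ
open import Data.Integer as ℤ using (ℤ; +_; -[1+_]; +[1+_]; 0ℤ; _≤ᵇ_; _*_)
import Data.Integer.Properties as ℤₚ
import Data.Integer.Tactic.RingSolver as ℤ-Solver
open import Data.Product using (_×_; _,_; proj₂)
open import Data.Product.Function.NonDependent.Propositional using (_×-⇔_)
open import Data.Sum using (_⊎_; inj₁; inj₂; [_,_]′)
open import Data.Sum.Function.Propositional using (_⊎-⇔_)
open import Data.Unit using (tt)
open import Data.Empty using (⊥-elim)
open import Function using (_∘_; id; _⇔_; mk⇔; Equivalence)
open import Function.Construct.Composition using (_⇔-∘_)
open import Relation.Binary.PropositionalEquality
open import Relation.Nullary using (¬_; yes; no)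
open import Relation.Binary.Definitions using (tri<; tri≈; tri>)
import Tactic.RingSolver.Core.AlmostCommutativeRing as ACR
open import Tactic.RingSolver using (solve-∀)

-- The ring ℤ[α]

𝟘 : ℤα
𝟘 = fromℕ 0

⊕-assoc : ∀ x y z → (x ⊕ y) ⊕ z ≡ x ⊕ (y ⊕ z)
⊕-assoc x y z = cong₂ _+_·α (ℤₚ.+-assoc (re x) (re y) (re z)) (ℤₚ.+-assoc (im x) (im y) (im z))

⊕-comm : ∀ x y → x ⊕ y ≡ y ⊕ x
⊕-comm x y = cong₂ _+_·α (ℤₚ.+-comm (re x) (re y)) (ℤₚ.+-comm (im x) (im y))

⊕-identityˡ : ∀ x → 𝟘 ⊕ x ≡ x
⊕-identityˡ x = cong₂ _+_·α (ℤₚ.+-identityˡ (re x)) (ℤₚ.+-identityˡ (im x))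

⊝-inverseˡ : ∀ x → ⊝ x ⊕ x ≡ 𝟘
⊝-inverseˡ x = cong₂ _+_·α (ℤₚ.+-inverseˡ (re x)) (ℤₚ.+-inverseˡ (im x))

⊗-assoc : ∀ x y z → (x ⊗ y) ⊗ z ≡ x ⊗ (y ⊗ z)
⊗-assoc (a + b ·α) (c + d ·α) (e + f ·α) = cong₂ _+_·α (re-assoc a b c d e f) (im-assoc a b c d e f)
  where
  open import Data.Integer.Base using (_+_)
  re-assoc : ∀ a b c d e f →
    (a * c + b * d) * e + (a * d + b * c + b * d) * f ≡
    a * (c * e + d * f) + b * (c * f + d * e + d * f)
  re-assoc = ℤ-Solver.solve-∀
  im-assoc : ∀ a b c d e f →
    (a * c + b * d) * f + (a * d + b * c + b * d) * e + (a * d + b * c + b * d) * f ≡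
    a * (c * f + d * e + d * f) + b * (c * e + d * f) + b * (c * f + d * e + d * f)
  im-assoc = ℤ-Solver.solve-∀

⊗-comm : ∀ x y → x ⊗ y ≡ y ⊗ x
⊗-comm (a + b ·α) (c + d ·α) = cong₂ _+_·α (re-comm a b c d) (im-comm a b c d)
  where
  open import Data.Integer.Base using (_+_)
  re-comm : ∀ a b c d → a * c + b * d ≡ c * a + d * b
  re-comm = ℤ-Solver.solve-∀
  im-comm : ∀ a b c d → a * d + b * c + b * d ≡ c * b + d * a + d * b
  im-comm = ℤ-Solver.solve-∀

⊗-identityˡ : ∀ x → 𝟙 ⊗ x ≡ x
⊗-identityˡ (a + b ·α) = cong₂ _+_·α (re-id a b) (im-id a b)
  where
  open import Data.Integer.Base using (_+_)
  re-id : ∀ a b → + 1 * a + + 0 * b ≡ a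
  re-id = ℤ-Solver.solve-∀
  im-id : ∀ a b → + 1 * b + + 0 * a + + 0 * b ≡ b
  im-id = ℤ-Solver.solve-∀

⊗-distribˡ-⊕ : ∀ x y z → x ⊗ (y ⊕ z) ≡ x ⊗ y ⊕ x ⊗ z
⊗-distribˡ-⊕ (a + b ·α) (c + d ·α) (e + f ·α) = cong₂ _+_·α (re-distrib a b c d e f) (im-distrib a b c d e f)
  where
  open import Data.Integer.Base using (_+_)
  re-distrib : ∀ a b c d e f → a * (c + e) + b * (d + f) ≡ (a * c + b * d) + (a * e + b * f)
  re-distrib = ℤ-Solver.solve-∀
  im-distrib : ∀ a b c d e f →
    a * (d + f) + b * (c + e) + b * (d + f) ≡ (a * d + b * c + b * d) + (a * f + b * e + b * f)
  im-distrib = ℤ-Solver.solve-∀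

ℤα-isCommutativeRing : IsCommutativeRing _≡_ _⊕_ _⊗_ ⊝_ 𝟘 𝟙
ℤα-isCommutativeRing = record
  { isRing = record
    { +-isAbelianGroup = record
      { isGroup = record
        { isMonoid = record
          { isSemigroup = record
            { isMagma = record { isEquivalence = isEquivalence ; ∙-cong = cong₂ _⊕_ }
            ; assoc = ⊕-assoc }
          ; identity = comm∧idˡ⇒id ⊕-comm ⊕-identityˡ }
        ; inverse = comm∧invˡ⇒inv ⊕-comm ⊝-inverseˡ
        ; ⁻¹-cong = cong ⊝_ }
      ; comm = ⊕-comm }
    ; *-cong = cong₂ _⊗_
    ; *-assoc = ⊗-assoc
    ; *-identity = comm∧idˡ⇒id ⊗-comm ⊗-identityˡ
    ; distrib = ⊗-distribˡ-⊕ , comm∧distrˡ⇒distrʳ ⊗-comm ⊗-distribˡ-⊕ }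
  ; *-comm = ⊗-comm }

ℤα-commutativeRing : CommutativeRing _ _
ℤα-commutativeRing = record { isCommutativeRing = ℤα-isCommutativeRing }

ℤα-ring : ACR.AlmostCommutativeRing _ _
ℤα-ring = ACR.fromCommutativeRing ℤα-commutativeRing 𝟘≟_
  where
  𝟘≟_ : ∀ x → Maybe (𝟘 ≡ x)
  𝟘≟ (a + b ·α) with + 0 ℤ.≟ a | + 0 ℤ.≟ b
  ... | yes refl | yes refl = just refl
  ... | _        | _        = nothing

⊗-identityʳ : ∀ x → x ⊗ 𝟙 ≡ x
⊗-identityʳ = solve-∀ ℤα-ring

fromℕ-+ : ∀ m n → fromℕ (m ℕ.+ n) ≡ fromℕ m ⊕ fromℕ n
fromℕ-+ m n = cong₂ _+_·α (ℤₚ.pos-+ m n) refl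

fromℕ-* : ∀ m n → fromℕ (m ℕ.* n) ≡ fromℕ m ⊗ fromℕ n
fromℕ-* m n = cong₂ _+_·α (trans (ℤₚ.pos-* m n) (re-coord (+ m) (+ n))) (im-coord (+ m) (+ n))
  where
  open import Data.Integer.Base using (_+_)
  re-coord : ∀ i j → i * j ≡ i * j + + 0 * + 0
  re-coord = ℤ-Solver.solve-∀
  im-coord : ∀ i j → + 0 ≡ i * + 0 + + 0 * j + + 0 * + 0
  im-coord = ℤ-Solver.solve-∀

-- Powers of α

^-distribˡ-+-⊗ : ∀ x m n → x ^ (m ℕ.+ n) ≡ x ^ m ⊗ x ^ n
^-distribˡ-+-⊗ x zero    n = sym (⊗-identityˡ (x ^ n))
^-distribˡ-+-⊗ x (suc m) n = trans (cong (x ⊗_) (^-distribˡ-+-⊗ x m n)) (sym (⊗-assoc x (x ^ m) (x ^ n)))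

^-*-assoc : ∀ x m n → (x ^ m) ^ n ≡ x ^ (m ℕ.* n)
^-*-assoc x m zero    = cong (x ^_) (sym (ℕₚ.*-zeroʳ m))
^-*-assoc x m (suc n) = begin
  x ^ m ⊗ (x ^ m) ^ n      ≡⟨ cong (x ^ m ⊗_) (^-*-assoc x m n) ⟩
  x ^ m ⊗ x ^ (m ℕ.* n)    ≡⟨ ^-distribˡ-+-⊗ x m (m ℕ.* n) ⟨
  x ^ (m ℕ.+ m ℕ.* n)      ≡⟨ cong (x ^_) (ℕₚ.*-suc m n) ⟨
  x ^ (m ℕ.* suc n)        ∎
  where open ≡-Reasoning

^-distribʳ-⊗ : ∀ x y n → (x ⊗ y) ^ n ≡ x ^ n ⊗ y ^ n
^-distribʳ-⊗ x y zero    = refl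
^-distribʳ-⊗ x y (suc n) = trans (cong (x ⊗ y ⊗_) (^-distribʳ-⊗ x y n)) (interchange x y (x ^ n) (y ^ n))
  where
  interchange : ∀ x y z w → x ⊗ y ⊗ (z ⊗ w) ≡ x ⊗ z ⊗ (y ⊗ w)
  interchange = solve-∀ ℤα-ring

α^-⊖ : ∀ m n → α^ (m ℤ.⊖ n) ≡ α ^ m ⊗ α⁻¹ ^ n
α^-⊖ m       zero    = sym (⊗-identityʳ (α ^ m))
α^-⊖ zero    (suc n) = sym (⊗-identityˡ (α⁻¹ ^ suc n))
α^-⊖ (suc m) (suc n) = begin
  α^ (suc m ℤ.⊖ suc n)               ≡⟨ cong α^ (ℤₚ.[1+m]⊖[1+n]≡m⊖n m n) ⟩
  α^ (m ℤ.⊖ n)                       ≡⟨ α^-⊖ m n ⟩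
  α ^ m ⊗ α⁻¹ ^ n                    ≡⟨ cancel (α ^ m) (α⁻¹ ^ n) ⟩
  α ⊗ α ^ m ⊗ (α⁻¹ ⊗ α⁻¹ ^ n)        ∎
  where
  open ≡-Reasoning
  -- α ⊗ α⁻¹ computes to 𝟙.
  cancel : ∀ x y → x ⊗ y ≡ α ⊗ x ⊗ (α⁻¹ ⊗ y)
  cancel x y = trans (sym (⊗-identityʳ (x ⊗ y))) (reassoc x y)
    where
    reassoc : ∀ x y → x ⊗ y ⊗ (α ⊗ α⁻¹) ≡ α ⊗ x ⊗ (α⁻¹ ⊗ y)
    reassoc = solve-∀ ℤα-ring

α^-homo : ∀ i j → α^ (i ℤ.+ j) ≡ α^ i ⊗ α^ j
α^-homo (+ m)    (+ n)    = ^-distribˡ-+-⊗ α m n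
α^-homo (+ m)    -[1+ n ] = α^-⊖ m (suc n)
α^-homo -[1+ m ] (+ n)    = trans (α^-⊖ n (suc m)) (⊗-comm (α ^ n) (α⁻¹ ^ suc m))
α^-homo -[1+ m ] -[1+ n ] =
  trans (cong (α⁻¹ ^_) (cong suc (sym (ℕₚ.+-suc m n)))) (^-distribˡ-+-⊗ α⁻¹ (suc m) (suc n))

α^-inverse : ∀ m → α ^ m ⊗ α⁻¹ ^ m ≡ 𝟙
α^-inverse m = trans (sym (α^-⊖ m m)) (cong α^ (ℤₚ.n⊖n≡0 m))

α^-scale : ∀ n s → α ^ (n ℕ.+ n) ⊗ α^ (+ n ℤ.* (+ s ℤ.- + 2)) ≡ α ^ (n ℕ.* s)
α^-scale n s = begin
  α^ (+ (n ℕ.+ n)) ⊗ α^ (+ n ℤ.* (+ s ℤ.- + 2))    ≡⟨ α^-homo (+ (n ℕ.+ n)) (+ n ℤ.* (+ s ℤ.- + 2)) ⟨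
  α^ (+ (n ℕ.+ n) ℤ.+ + n ℤ.* (+ s ℤ.- + 2))       ≡⟨ cong α^ exponent ⟩
  α^ (+ (n ℕ.* s))                                  ∎
  where
  open ≡-Reasoning
  open import Data.Integer.Base using (_+_; _-_)
  cancel : ∀ n s → n + n + n * (s - + 2) ≡ n * s
  cancel = ℤ-Solver.solve-∀
  exponent : + (n ℕ.+ n) + + n * (+ s - + 2) ≡ + (n ℕ.* s)
  exponent = trans (cong (_+ + n * (+ s - + 2)) (ℤₚ.pos-+ n n)) (trans (cancel (+ n) (+ s)) (sym (ℤₚ.pos-* n s)))

-- Positivity through natural coordinates

data ℕ[α] : ℤα → Set where
  ℕ-coords : (c d : ℕ) → ℕ[α] ((+ c) + (+ d) ·α)

data ℕ[α]⁺ : ℤα → Set where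
  ℕ-coords⁺ : (c d : ℕ) → 1 ℕ.≤ c ℕ.+ d → ℕ[α]⁺ ((+ c) + (+ d) ·α)

ℕ[α]⁺⇒ℕ[α] : ∀ {x} → ℕ[α]⁺ x → ℕ[α] x
ℕ[α]⁺⇒ℕ[α] (ℕ-coords⁺ c d _) = ℕ-coords c d

pos-coords-⊕ : ∀ c d e f →
  (+ (c ℕ.+ e)) + (+ (d ℕ.+ f)) ·α ≡ ((+ c) + (+ d) ·α) ⊕ ((+ e) + (+ f) ·α)
pos-coords-⊕ c d e f = cong₂ _+_·α (ℤₚ.pos-+ c e) (ℤₚ.pos-+ d f)

pos-coords-⊗ : ∀ c d e f → (+ (c ℕ.* e ℕ.+ d ℕ.* f)) + (+ (c ℕ.* f ℕ.+ d ℕ.* e ℕ.+ d ℕ.* f)) ·α ≡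
  ((+ c) + (+ d) ·α) ⊗ ((+ e) + (+ f) ·α)
pos-coords-⊗ c d e f = cong₂ _+_·α
  (trans (ℤₚ.pos-+ (c ℕ.* e) (d ℕ.* f)) (cong₂ ℤ._+_ (ℤₚ.pos-* c e) (ℤₚ.pos-* d f)))
  (trans (ℤₚ.pos-+ (c ℕ.* f ℕ.+ d ℕ.* e) (d ℕ.* f))
    (cong₂ ℤ._+_ (trans (ℤₚ.pos-+ (c ℕ.* f) (d ℕ.* e)) (cong₂ ℤ._+_ (ℤₚ.pos-* c f) (ℤₚ.pos-* d e)))
                 (ℤₚ.pos-* d f)))

ℕ[α]-⊕ : ∀ {x y} → ℕ[α] x → ℕ[α] y → ℕ[α] (x ⊕ y)
ℕ[α]-⊕ (ℕ-coords c d) (ℕ-coords e f) = subst ℕ[α] (pos-coords-⊕ c d e f) (ℕ-coords _ _)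

ℕ[α]-⊗ : ∀ {x y} → ℕ[α] x → ℕ[α] y → ℕ[α] (x ⊗ y)
ℕ[α]-⊗ (ℕ-coords c d) (ℕ-coords e f) = subst ℕ[α] (pos-coords-⊗ c d e f) (ℕ-coords _ _)

ℕ[α]⁺-⊕ : ∀ {x y} → ℕ[α]⁺ x → ℕ[α] y → ℕ[α]⁺ (x ⊕ y)
ℕ[α]⁺-⊕ (ℕ-coords⁺ c d 1≤c+d) (ℕ-coords e f) = subst ℕ[α]⁺ (pos-coords-⊕ c d e f)
  (ℕ-coords⁺ _ _ (ℕₚ.≤-trans 1≤c+d (ℕₚ.+-mono-≤ (ℕₚ.m≤m+n c e) (ℕₚ.m≤m+n d f))))

ℕ[α]⁺-⊗ : ∀ {x y} → ℕ[α]⁺ x → ℕ[α]⁺ y → ℕ[α]⁺ (x ⊗ y)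
ℕ[α]⁺-⊗ (ℕ-coords⁺ c d 1≤c+d) (ℕ-coords⁺ e f 1≤e+f) = subst ℕ[α]⁺ (pos-coords-⊗ c d e f)
  (ℕ-coords⁺ _ _ (subst (1 ℕ.≤_) (sym (coords-sum c d e f))
    (ℕₚ.≤-trans (ℕₚ.*-mono-≤ 1≤c+d 1≤e+f) (ℕₚ.m≤m+n ((c ℕ.+ d) ℕ.* (e ℕ.+ f)) (d ℕ.* f)))))
  where
  open import Data.Nat.Tactic.RingSolver using () renaming (solve-∀ to ℕ-solve-∀)
  coords-sum : ∀ c d e f →
    c ℕ.* e ℕ.+ d ℕ.* f ℕ.+ (c ℕ.* f ℕ.+ d ℕ.* e ℕ.+ d ℕ.* f) ≡ (c ℕ.+ d) ℕ.* (e ℕ.+ f) ℕ.+ d ℕ.* f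
  coords-sum = ℕ-solve-∀

ℕ[α]⁺-α^ : ∀ k → ℕ[α]⁺ (α ^ k)
ℕ[α]⁺-α^ zero    = ℕ-coords⁺ 1 0 ℕₚ.≤-refl
ℕ[α]⁺-α^ (suc k) = ℕ[α]⁺-⊗ (ℕ-coords⁺ 0 1 ℕₚ.≤-refl) (ℕ[α]⁺-α^ k)

data Eventually (P : ℤα → Set) (x : ℤα) : Set where
  _,_ : (m : ℕ) → P (x ⊗ α ^ m) → Eventually P x

NonNegative Positive : ℤα → Set
NonNegative = Eventually ℕ[α]
Positive    = Eventually ℕ[α]⁺

module _ {P : ℤα → Set} where

  eventually : ∀ {x} → P x → Eventually P x
  eventually {x} p = 0 , subst P (sym (⊗-identityʳ x)) p

  eventually-cancel : ∀ {x} k → Eventually P (x ⊗ α ^ k) → Eventually P x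
  eventually-cancel {x} k (m , p) = k ℕ.+ m , subst P (reassoc x k m) p
    where
    reassoc : ∀ x k m → x ⊗ α ^ k ⊗ α ^ m ≡ x ⊗ α ^ (k ℕ.+ m)
    reassoc x k m = trans (⊗-assoc x (α ^ k) (α ^ m)) (cong (x ⊗_) (sym (^-distribˡ-+-⊗ α k m)))

  eventually-subst : ∀ {x y} → x ≡ y → Eventually P x → Eventually P y
  eventually-subst = subst (Eventually P)

module _ {P Q R : ℤα → Set} where

  eventually-⊗ : (∀ {x y} → P x → Q y → R (x ⊗ y)) →
    ∀ {x y} → Eventually P x → Eventually Q y → Eventually R (x ⊗ y)
  eventually-⊗ closed {x} {y} (m , p) (k , q) = m ℕ.+ k , subst R (sym (reassoc x y m k)) (closed {x ⊗ α ^ m} {y ⊗ α ^ k} p q)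
    where
    reassoc : ∀ x y m k → x ⊗ y ⊗ α ^ (m ℕ.+ k) ≡ x ⊗ α ^ m ⊗ (y ⊗ α ^ k)
    reassoc x y m k = trans (cong (x ⊗ y ⊗_) (^-distribˡ-+-⊗ α m k)) (interchange x y (α ^ m) (α ^ k))
      where
      interchange : ∀ x y z w → x ⊗ y ⊗ (z ⊗ w) ≡ x ⊗ z ⊗ (y ⊗ w)
      interchange = solve-∀ ℤα-ring

  eventually-⊕ : (∀ {x} k → P x → P (x ⊗ α ^ k)) → (∀ {y} k → Q y → Q (y ⊗ α ^ k)) →
    (∀ {x y} → P x → Q y → R (x ⊕ y)) →
    ∀ {x y} → Eventually P x → Eventually Q y → Eventually R (x ⊕ y)
  eventually-⊕ P-α Q-α closed {x} {y} (m , p) (k , q) =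
    m ℕ.+ k , subst R (sym (reassoc x y m k)) (closed (P-α {x ⊗ α ^ m} k p) (Q-α {y ⊗ α ^ k} m q))
    where
    reassoc : ∀ x y m k → (x ⊕ y) ⊗ α ^ (m ℕ.+ k) ≡ x ⊗ α ^ m ⊗ α ^ k ⊕ y ⊗ α ^ k ⊗ α ^ m
    reassoc x y m k = trans (cong ((x ⊕ y) ⊗_) (^-distribˡ-+-⊗ α m k)) (expand x y (α ^ m) (α ^ k))
      where
      expand : ∀ x y z w → (x ⊕ y) ⊗ (z ⊗ w) ≡ x ⊗ z ⊗ w ⊕ y ⊗ w ⊗ z
      expand = solve-∀ ℤα-ring

ℕ[α]-⊗α^ : ∀ {x} k → ℕ[α] x → ℕ[α] (x ⊗ α ^ k)
ℕ[α]-⊗α^ k p = ℕ[α]-⊗ p (ℕ[α]⁺⇒ℕ[α] (ℕ[α]⁺-α^ k))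

ℕ[α]⁺-⊗α^ : ∀ {x} k → ℕ[α]⁺ x → ℕ[α]⁺ (x ⊗ α ^ k)
ℕ[α]⁺-⊗α^ k p = ℕ[α]⁺-⊗ p (ℕ[α]⁺-α^ k)

positive⇒nonNegative : ∀ {x} → Positive x → NonNegative x
positive⇒nonNegative (m , p) = m , ℕ[α]⁺⇒ℕ[α] p

nonNegative-⊕ : ∀ {x y} → NonNegative x → NonNegative y → NonNegative (x ⊕ y)
nonNegative-⊕ = eventually-⊕ ℕ[α]-⊗α^ ℕ[α]-⊗α^ ℕ[α]-⊕

positive-⊕ : ∀ {x y} → Positive x → NonNegative y → Positive (x ⊕ y)
positive-⊕ = eventually-⊕ ℕ[α]⁺-⊗α^ ℕ[α]-⊗α^ ℕ[α]⁺-⊕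

nonNegative-⊗ : ∀ {x y} → NonNegative x → NonNegative y → NonNegative (x ⊗ y)
nonNegative-⊗ = eventually-⊗ ℕ[α]-⊗

nonNegative-fromℕ : ∀ t → NonNegative (fromℕ t)
nonNegative-fromℕ t = eventually (ℕ-coords t 0)

positive-α^ : ∀ k → Positive (α ^ k)
positive-α^ k = eventually (ℕ[α]⁺-α^ k)

nonNegative-^ : ∀ {x} → NonNegative x → ∀ k → NonNegative (x ^ k)
nonNegative-^ 0≼x zero    = nonNegative-fromℕ 1
nonNegative-^ 0≼x (suc k) = nonNegative-⊗ 0≼x (nonNegative-^ 0≼x k)

nonNegative-√5 : NonNegative √5
nonNegative-√5 = 1 , ℕ-coords 2 1

-- Agreement with pos?

T-not : ∀ {b} → T (not b) ⇔ (¬ T b)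
T-not {false} = mk⇔ (λ _ ()) (λ _ → tt)
T-not {true}  = mk⇔ (λ ()) (λ ¬⊤ → ¬⊤ tt)

T-≤ᵇ : ∀ {i j} → T (i ≤ᵇ j) ⇔ i ℤ.≤ j
T-≤ᵇ = mk⇔ ℤₚ.≤ᵇ⇒≤ ℤₚ.≤⇒≤ᵇ

T-<ᵇᶻ : ∀ {i j} → T (i <ᵇᶻ j) ⇔ i ℤ.< j
T-<ᵇᶻ = mk⇔ (λ t → ℤₚ.≰⇒> (Equivalence.to T-not t ∘ ℤₚ.≤⇒≤ᵇ))
            (λ i<j → Equivalence.from T-not (ℤₚ.<⇒≱ i<j ∘ ℤₚ.≤ᵇ⇒≤))

PositivePQ : ℤ → ℤ → Set
PositivePQ p q = (0ℤ ℤ.≤ p × 0ℤ ℤ.≤ q × (0ℤ ℤ.< p ⊎ 0ℤ ℤ.< q))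
               ⊎ (0ℤ ℤ.< p × q ℤ.< 0ℤ × + 5 ℤ.* (q ℤ.* q) ℤ.< p ℤ.* p)
               ⊎ (p ℤ.< 0ℤ × 0ℤ ℤ.< q × p ℤ.* p ℤ.< + 5 ℤ.* (q ℤ.* q))

pattern nonNegative-pq 0≤p 0≤q 0<p⊎0<q = inj₁ (0≤p , 0≤q , 0<p⊎0<q)
pattern negative-q 0<p q<0 5q²<p² = inj₂ (inj₁ (0<p , q<0 , 5q²<p²))
pattern negative-p p<0 0<q p²<5q² = inj₂ (inj₂ (p<0 , 0<q , p²<5q²))

T-posPQ : ∀ {p q} → T (posPQ p q) ⇔ PositivePQ p q
T-posPQ = (T-∧₃ T-≤ᵇ T-≤ᵇ ((T-<ᵇᶻ ⊎-⇔ T-<ᵇᶻ) ⇔-∘ T-∨)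
          ⊎-⇔ (T-∧₃ T-<ᵇᶻ T-<ᵇᶻ T-<ᵇᶻ ⊎-⇔ T-∧₃ T-<ᵇᶻ T-<ᵇᶻ T-<ᵇᶻ) ⇔-∘ T-∨) ⇔-∘ T-∨
  where
  T-∧₃ : ∀ {a b c A B C} → T a ⇔ A → T b ⇔ B → T c ⇔ C → T (a ∧ b ∧ c) ⇔ (A × B × C)
  T-∧₃ a b c = (a ×-⇔ ((b ×-⇔ c) ⇔-∘ T-∧)) ⇔-∘ T-∧

module _ where
  open import Data.Integer.Base using (_+_; _-_; -_)

  0<* : ∀ {i j} → 0ℤ ℤ.< i → 0ℤ ℤ.< j → 0ℤ ℤ.< i * j
  0<* {j = j} 0<i 0<j = ℤₚ.*-monoʳ-<-pos j {{ℤ.positive 0<j}} 0<i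

  0≤* : ∀ {i j} → 0ℤ ℤ.≤ i → 0ℤ ℤ.≤ j → 0ℤ ℤ.≤ i * j
  0≤* {j = j} 0≤i 0≤j = ℤₚ.*-monoʳ-≤-nonNeg j {{ℤ.nonNegative 0≤j}} 0≤i

  0<-⇒< : ∀ {i j} → 0ℤ ℤ.< j - i → i ℤ.< j
  0<-⇒< {i} {j} 0<j-i = subst₂ ℤ._<_ (ℤₚ.+-identityˡ i) (cancel j i) (ℤₚ.+-mono-<-≤ 0<j-i (ℤₚ.≤-refl {i}))
    where
    cancel : ∀ j i → j - i + i ≡ j
    cancel = ℤ-Solver.solve-∀

  <⇒0<- : ∀ {i j} → i ℤ.< j → 0ℤ ℤ.< j - i
  <⇒0<- {i} {j} i<j = subst (ℤ._< j - i) (ℤₚ.+-inverseʳ i) (ℤₚ.+-mono-<-≤ i<j (ℤₚ.≤-refl { - i}))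

  -- (a + bα) α⁻¹ = (b − a) + aα, so (p, q) = (2a + b, b) becomes (2b − a, a); the square conditions
  -- follow from 5a² − (2b − a)² = (2a + b)² − 5b².
  positivePQ-α⁻¹ : ∀ a b → PositivePQ (+ 2 * a + b) b → PositivePQ (+ 2 * b - a) a
  positivePQ-α⁻¹ a b (nonNegative-pq 0≤p 0≤b 0<p⊎0<b) with ℤₚ.<-cmp 0ℤ a
  ... | tri< 0<a _ _ with 0ℤ ℤ.≤? + 2 * b - a
  ...   | yes 0≤p′ = nonNegative-pq 0≤p′ (ℤₚ.<⇒≤ 0<a) (inj₂ 0<a)
  ...   | no  p′≱0 = negative-p p′<0 0<a (0<-⇒< (subst (0ℤ ℤ.<_) (difference a b) 0<difference))
    where
    p′<0 : + 2 * b - a ℤ.< 0ℤ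
    p′<0 = ℤₚ.≰⇒> p′≱0
    0<k : 0ℤ ℤ.< a - + 2 * b
    0<k = subst (0ℤ ℤ.<_) (negate a b) (ℤₚ.neg-mono-< p′<0)
      where
      negate : ∀ a b → - (+ 2 * b - a) ≡ a - + 2 * b
      negate = ℤ-Solver.solve-∀
    0<difference : 0ℤ ℤ.< + 4 * ((a - + 2 * b) * (a - + 2 * b) + + 5 * (b * b + b * (a - + 2 * b)))
    0<difference = 0<* {+ 4} (ℤ.+<+ ℕ.z<s) (ℤₚ.+-mono-<-≤ (0<* 0<k 0<k)
      (0≤* {+ 5} (ℤ.+≤+ ℕ.z≤n) (ℤₚ.+-mono-≤ (0≤* 0≤b 0≤b) (0≤* 0≤b (ℤₚ.<⇒≤ 0<k)))))
    difference : ∀ a b → + 4 * ((a - + 2 * b) * (a - + 2 * b) + + 5 * (b * b + b * (a - + 2 * b))) ≡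
                          + 5 * (a * a) - (+ 2 * b - a) * (+ 2 * b - a)
    difference = ℤ-Solver.solve-∀
  positivePQ-α⁻¹ a b (nonNegative-pq 0≤p 0≤b 0<p⊎0<b) | tri≈ _ refl _ =
    nonNegative-pq (ℤₚ.<⇒≤ 0<p′) ℤₚ.≤-refl (inj₁ 0<p′)
    where
    0<b : 0ℤ ℤ.< b
    0<b = [ subst (0ℤ ℤ.<_) (ℤₚ.+-identityˡ b) , id ]′ 0<p⊎0<b
    0<p′ : 0ℤ ℤ.< + 2 * b - 0ℤ
    0<p′ = subst (0ℤ ℤ.<_) (double b) (ℤₚ.+-mono-< 0<b 0<b)
      where
      double : ∀ b → b + b ≡ + 2 * b - 0ℤ
      double = ℤ-Solver.solve-∀
  positivePQ-α⁻¹ a b (nonNegative-pq 0≤p 0≤b 0<p⊎0<b) | tri> _ _ a<0 =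
    negative-q 0<p′ a<0 (0<-⇒< (subst (0ℤ ℤ.<_) (difference a b) 0<difference))
    where
    0<c : 0ℤ ℤ.< - a
    0<c = ℤₚ.neg-mono-< a<0
    0<p′ : 0ℤ ℤ.< + 2 * b - a
    0<p′ = subst (0ℤ ℤ.<_) (split a b) (ℤₚ.+-mono-≤-< (0≤* {+ 2} (ℤ.+≤+ ℕ.z≤n) 0≤p) (0<* {+ 5} (ℤ.+<+ ℕ.z<s) 0<c))
      where
      split : ∀ a b → + 2 * (+ 2 * a + b) + + 5 * (- a) ≡ + 2 * b - a
      split = ℤ-Solver.solve-∀
    0<difference : 0ℤ ℤ.< + 4 * ((+ 2 * a + b) * (+ 2 * a + b) + + 5 * ((+ 2 * a + b) * - a + - a * - a))
    0<difference = 0<* {+ 4} (ℤ.+<+ ℕ.z<s) (ℤₚ.+-mono-≤-< (0≤* 0≤p 0≤p)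
      (0<* {+ 5} (ℤ.+<+ ℕ.z<s) (ℤₚ.+-mono-≤-< (0≤* 0≤p (ℤₚ.<⇒≤ 0<c)) (0<* 0<c 0<c))))
    difference : ∀ a b → + 4 * ((+ 2 * a + b) * (+ 2 * a + b) + + 5 * ((+ 2 * a + b) * - a + - a * - a)) ≡
                          (+ 2 * b - a) * (+ 2 * b - a) - + 5 * (a * a)
    difference = ℤ-Solver.solve-∀
  positivePQ-α⁻¹ a b (negative-q 0<p b<0 5b²<p²) =
    negative-p p′<0 0<a (0<-⇒< (subst (0ℤ ℤ.<_) (difference a b) (<⇒0<- 5b²<p²)))
    where
    0<a : 0ℤ ℤ.< a
    0<a = ℤₚ.*-cancelˡ-<-nonNeg (+ 2) (subst (0ℤ ℤ.<_) (cancel a b) (ℤₚ.+-mono-< 0<p (ℤₚ.neg-mono-< b<0)))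
      where
      cancel : ∀ a b → + 2 * a + b + - b ≡ + 2 * a
      cancel = ℤ-Solver.solve-∀
    p′<0 : + 2 * b - a ℤ.< 0ℤ
    p′<0 = ℤₚ.neg-cancel-< (subst (0ℤ ℤ.<_) (negate a b) (ℤₚ.+-mono-<-≤ 0<a (0≤* {+ 2} (ℤ.+≤+ ℕ.z≤n) (ℤₚ.<⇒≤ (ℤₚ.neg-mono-< b<0)))))
      where
      negate : ∀ a b → a + + 2 * - b ≡ - (+ 2 * b - a)
      negate = ℤ-Solver.solve-∀
    difference : ∀ a b → (+ 2 * a + b) * (+ 2 * a + b) - + 5 * (b * b) ≡ + 5 * (a * a) - (+ 2 * b - a) * (+ 2 * b - a)
    difference = ℤ-Solver.solve-∀
  positivePQ-α⁻¹ a b (negative-p p<0 0<b p²<5b²) =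
    negative-q 0<p′ a<0 (0<-⇒< (subst (0ℤ ℤ.<_) (difference a b) (<⇒0<- p²<5b²)))
    where
    a<0 : a ℤ.< 0ℤ
    a<0 = ℤₚ.neg-cancel-< (ℤₚ.*-cancelˡ-<-nonNeg (+ 2) (subst (0ℤ ℤ.<_) (cancel a b) (ℤₚ.+-mono-< (ℤₚ.neg-mono-< p<0) 0<b)))
      where
      cancel : ∀ a b → - (+ 2 * a + b) + b ≡ + 2 * - a
      cancel = ℤ-Solver.solve-∀
    0<p′ : 0ℤ ℤ.< + 2 * b - a
    0<p′ = ℤₚ.+-mono-< (0<* {+ 2} (ℤ.+<+ ℕ.z<s) 0<b) (ℤₚ.neg-mono-< a<0)
    difference : ∀ a b → + 5 * (b * b) - (+ 2 * a + b) * (+ 2 * a + b) ≡ (+ 2 * b - a) * (+ 2 * b - a) - + 5 * (a * a)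
    difference = ℤ-Solver.solve-∀

  square-neg : ∀ i → - i * - i ≡ i * i
  square-neg = ℤ-Solver.solve-∀

  positivePQ-asym : ∀ {p q} → PositivePQ p q → ¬ PositivePQ (- p) (- q)
  positivePQ-asym (nonNegative-pq _ _ (inj₁ 0<p)) (nonNegative-pq 0≤-p _ _) = ℤₚ.<⇒≱ 0<p (ℤₚ.neg-cancel-≤ 0≤-p)
  positivePQ-asym (nonNegative-pq _ _ (inj₂ 0<q)) (nonNegative-pq _ 0≤-q _) = ℤₚ.<⇒≱ 0<q (ℤₚ.neg-cancel-≤ 0≤-q)
  positivePQ-asym (nonNegative-pq 0≤p _ _)         (negative-q 0<-p _ _)     = ℤₚ.<⇒≱ (ℤₚ.neg-cancel-< 0<-p) 0≤p
  positivePQ-asym (nonNegative-pq _ 0≤q _)         (negative-p _ 0<-q _)     = ℤₚ.<⇒≱ (ℤₚ.neg-cancel-< 0<-q) 0≤q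
  positivePQ-asym (negative-q 0<p _ _)             (nonNegative-pq 0≤-p _ _) = ℤₚ.<⇒≱ 0<p (ℤₚ.neg-cancel-≤ 0≤-p)
  positivePQ-asym (negative-q 0<p _ _)             (negative-q 0<-p _ _)     = ℤₚ.<-asym 0<p (ℤₚ.neg-cancel-< 0<-p)
  positivePQ-asym {p} {q} (negative-q _ _ 5q²<p²)  (negative-p _ _ p²<5q²)   =
    ℤₚ.<-asym 5q²<p² (subst₂ ℤ._<_ (square-neg p) (cong (+ 5 *_) (square-neg q)) p²<5q²)
  positivePQ-asym (negative-p _ 0<q _)             (nonNegative-pq _ 0≤-q _) = ℤₚ.<⇒≱ 0<q (ℤₚ.neg-cancel-≤ 0≤-q)
  positivePQ-asym {p} {q} (negative-p _ _ p²<5q²)  (negative-q _ _ 5q²<p²)   =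
    ℤₚ.<-asym p²<5q² (subst₂ ℤ._<_ (cong (+ 5 *_) (square-neg q)) (square-neg p) 5q²<p²)
  positivePQ-asym (negative-p p<0 _ _)             (negative-p -p<0 _ _)     = ℤₚ.<-asym p<0 (ℤₚ.neg-cancel-< -p<0)

pos?-ℕ[α]⁺ : ∀ {x} → ℕ[α]⁺ x → T (pos? x)
pos?-ℕ[α]⁺ (ℕ-coords⁺ c d 1≤c+d) =
  Equivalence.from (T-posPQ {+ 2 * + c ℤ.+ + d} {+ d})
    (nonNegative-pq (ℤₚ.+-mono-≤ (0≤* {+ 2} {+ c} (ℤ.+≤+ ℕ.z≤n) (ℤ.+≤+ ℕ.z≤n)) (ℤ.+≤+ ℕ.z≤n))
                    (ℤ.+≤+ ℕ.z≤n) (some-coord-positive c d 1≤c+d))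
  where
  some-coord-positive : ∀ c d → 1 ℕ.≤ c ℕ.+ d → 0ℤ ℤ.< + 2 * + c ℤ.+ + d ⊎ 0ℤ ℤ.< + d
  some-coord-positive c       (suc d) _ = inj₂ (ℤ.+<+ ℕ.z<s)
  some-coord-positive (suc c) zero    _ = inj₁ (ℤₚ.+-mono-<-≤ (0<* {+ 2} {+ suc c} (ℤ.+<+ ℕ.z<s) (ℤ.+<+ ℕ.z<s)) (ℤₚ.≤-refl {+ 0}))

pos?-⊗α⁻¹ : ∀ x → T (pos? x) → T (pos? (x ⊗ α⁻¹))
pos?-⊗α⁻¹ (a + b ·α) pos =
  Equivalence.from T-posPQ (subst₂ PositivePQ (p-coord a b) (q-coord a b) (positivePQ-α⁻¹ a b (Equivalence.to T-posPQ pos)))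
  where
  open import Data.Integer.Base using (_+_; _-_)
  p-coord : ∀ a b → + 2 * b - a ≡ + 2 * (a * -[1+ 0 ] + b * + 1) + (a * + 1 + b * -[1+ 0 ] + b * + 1)
  p-coord = ℤ-Solver.solve-∀
  q-coord : ∀ a b → a ≡ a * + 1 + b * -[1+ 0 ] + b * + 1
  q-coord = ℤ-Solver.solve-∀

positive⇒pos? : ∀ {x} → Positive x → T (pos? x)
positive⇒pos? {x} (m , p) = subst (T ∘ pos?) (cancel x) (pos?-⊗α⁻¹^ m (x ⊗ α ^ m) (pos?-ℕ[α]⁺ p))
  where
  pos?-⊗α⁻¹^ : ∀ m y → T (pos? y) → T (pos? (y ⊗ α⁻¹ ^ m))
  pos?-⊗α⁻¹^ zero    y pos = subst (T ∘ pos?) (sym (⊗-identityʳ y)) pos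
  pos?-⊗α⁻¹^ (suc m) y pos = subst (T ∘ pos?) (⊗-assoc y α⁻¹ (α⁻¹ ^ m)) (pos?-⊗α⁻¹^ m (y ⊗ α⁻¹) (pos?-⊗α⁻¹ y pos))
  cancel : ∀ x → x ⊗ α ^ m ⊗ α⁻¹ ^ m ≡ x
  cancel x = begin
    x ⊗ α ^ m ⊗ α⁻¹ ^ m      ≡⟨ ⊗-assoc x (α ^ m) (α⁻¹ ^ m) ⟩
    x ⊗ (α ^ m ⊗ α⁻¹ ^ m)    ≡⟨ cong (x ⊗_) (α^-inverse m) ⟩
    x ⊗ 𝟙                    ≡⟨ ⊗-identityʳ x ⟩
    x                        ∎
    where open ≡-Reasoning

pos?-asym : ∀ x → T (pos? x) → ¬ T (pos? (⊝ x))
pos?-asym (a + b ·α) pos pos⁻ =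
  positivePQ-asym (Equivalence.to T-posPQ pos) (subst (λ p → PositivePQ p (ℤ.- b)) (p-coord a b) (Equivalence.to T-posPQ pos⁻))
  where
  open import Data.Integer.Base using (_+_; -_)
  p-coord : ∀ a b → + 2 * - a + - b ≡ - (+ 2 * a + b)
  p-coord = ℤ-Solver.solve-∀

Trichotomy : ℤα → Set
Trichotomy x = x ≡ 𝟘 ⊎ Positive x ⊎ Positive (⊝ x)

⊗α-coords : ∀ u v {w} → u ℤ.+ v ≡ w → (u + v ·α) ⊗ α ≡ v + w ·α
⊗α-coords u v refl = cong₂ _+_·α (re-coord u v) (im-coord u v)
  where
  open import Data.Integer.Base using (_+_)
  re-coord : ∀ u v → u * + 0 + v * + 1 ≡ v
  re-coord = ℤ-Solver.solve-∀
  im-coord : ∀ u v → u * + 1 + v * + 0 + v * + 1 ≡ u + v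
  im-coord = ℤ-Solver.solve-∀

opposite-sum : ∀ {m n k} → +[1+ m ] ℤ.+ -[1+ n ] ≡ +[1+ k ] → suc n ℕ.+ suc k ≡ suc m
opposite-sum {m} {n} {k} sum≡ = ℤₚ.+-injective (begin
  + (suc n ℕ.+ suc k)                     ≡⟨ ℤₚ.pos-+ (suc n) (suc k) ⟩
  +[1+ n ] ℤ.+ +[1+ k ]                   ≡⟨ cong (ℤ._+_ +[1+ n ]) sum≡ ⟨
  +[1+ n ] ℤ.+ (+[1+ m ] ℤ.+ -[1+ n ])    ≡⟨ cancel +[1+ m ] -[1+ n ] ⟩
  +[1+ m ]                                ∎)
  where
  open ≡-Reasoning
  open import Data.Integer.Base using (_+_; -_)
  cancel : ∀ i j → - j + (i + j) ≡ i
  cancel = ℤ-Solver.solve-∀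

fuel-decreases : ∀ {m n fuel} → suc m ℕ.+ suc n ℕ.≤ suc fuel → suc m ℕ.≤ fuel
fuel-decreases {m} {n} {fuel} bound = ℕₚ.≤-trans (ℕₚ.m≤m+n (suc m) n) (ℕₚ.≤-pred (subst (ℕ._≤ suc fuel) (ℕₚ.+-suc (suc m) n) bound))

positive-⊗α⁻¹ : ∀ {x y} → x ⊗ α ≡ y → Positive y → Positive x
positive-⊗α⁻¹ {x} refl = eventually-cancel 1 ∘ eventually-subst (cong (x ⊗_) (sym (⊗-identityʳ α)))

negative-⊗α⁻¹ : ∀ {x y} → x ⊗ α ≡ y → Positive (⊝ y) → Positive (⊝ x)
negative-⊗α⁻¹ {x} refl = positive-⊗α⁻¹ (neg-⊗ x α)
  where
  neg-⊗ : ∀ x y → ⊝ x ⊗ y ≡ ⊝ (x ⊗ y)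
  neg-⊗ = solve-∀ ℤα-ring

trichotomy-⊗α : ∀ {x y} → x ⊗ α ≡ y → Trichotomy y → Trichotomy x
trichotomy-⊗α {x} refl (inj₁ xα≡𝟘)       = inj₁ (begin
  x                  ≡⟨ ⊗-identityʳ x ⟨
  x ⊗ 𝟙              ≡⟨ ⊗-assoc x α α⁻¹ ⟨
  x ⊗ α ⊗ α⁻¹        ≡⟨ cong (_⊗ α⁻¹) xα≡𝟘 ⟩
  𝟘                  ∎)
  where open ≡-Reasoning
trichotomy-⊗α xα≡y (inj₂ (inj₁ pos)) = inj₂ (inj₁ (positive-⊗α⁻¹ xα≡y pos))
trichotomy-⊗α xα≡y (inj₂ (inj₂ neg)) = inj₂ (inj₂ (negative-⊗α⁻¹ xα≡y neg))

-- For coordinates of opposite signs, multiplying by α (u + vα ↦ v + (u + v)α) either makes the signs agree or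
-- strictly decreases |u| + |v|; the fuel bounds |u| + |v|.
trichotomy-fuel : ∀ fuel u v → ℤ.∣ u ∣ ℕ.+ ℤ.∣ v ∣ ℕ.≤ fuel → Trichotomy (u + v ·α)
trichotomy-fuel _ (+ zero)  (+ zero)  _ = inj₁ refl
trichotomy-fuel _ (+ zero)  (+ suc n) _ = inj₂ (inj₁ (eventually (ℕ-coords⁺ 0 (suc n) (ℕ.s≤s ℕ.z≤n))))
trichotomy-fuel _ (+ suc m) (+ n)     _ = inj₂ (inj₁ (eventually (ℕ-coords⁺ (suc m) n (ℕ.s≤s ℕ.z≤n))))
trichotomy-fuel _ (+ zero)  -[1+ n ]  _ = inj₂ (inj₂ (eventually (ℕ-coords⁺ 0 (suc n) (ℕ.s≤s ℕ.z≤n))))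
trichotomy-fuel _ -[1+ m ]  (+ zero)  _ = inj₂ (inj₂ (eventually (ℕ-coords⁺ (suc m) 0 (ℕ.s≤s ℕ.z≤n))))
trichotomy-fuel _ -[1+ m ]  -[1+ n ]  _ = inj₂ (inj₂ (eventually (ℕ-coords⁺ (suc m) (suc n) (ℕ.s≤s ℕ.z≤n))))
trichotomy-fuel (suc fuel) (+ suc m) -[1+ n ] bound with +[1+ m ] ℤ.+ -[1+ n ] in sum≡
... | + zero   = inj₂ (inj₂ (negative-⊗α⁻¹ (⊗α-coords +[1+ m ] -[1+ n ] sum≡) (eventually (ℕ-coords⁺ (suc n) 0 (ℕ.s≤s ℕ.z≤n)))))
... | -[1+ k ] = inj₂ (inj₂ (negative-⊗α⁻¹ (⊗α-coords +[1+ m ] -[1+ n ] sum≡) (eventually (ℕ-coords⁺ (suc n) (suc k) (ℕ.s≤s ℕ.z≤n)))))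
... | +[1+ k ] = trichotomy-⊗α (⊗α-coords +[1+ m ] -[1+ n ] sum≡) (trichotomy-fuel fuel -[1+ n ] +[1+ k ]
                   (subst (ℕ._≤ fuel) (sym (opposite-sum sum≡)) (fuel-decreases bound)))
trichotomy-fuel (suc fuel) -[1+ m ] (+ suc n) bound with -[1+ m ] ℤ.+ +[1+ n ] in sum≡
... | + k      = inj₂ (inj₁ (positive-⊗α⁻¹ (⊗α-coords -[1+ m ] +[1+ n ] sum≡) (eventually (ℕ-coords⁺ (suc n) k (ℕ.s≤s ℕ.z≤n)))))
... | -[1+ k ] = trichotomy-⊗α (⊗α-coords -[1+ m ] +[1+ n ] sum≡) (trichotomy-fuel fuel +[1+ n ] -[1+ k ]
                   (subst (ℕ._≤ fuel) (sym (opposite-sum negated-sum≡)) (fuel-decreases bound)))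
  where
  negated-sum≡ : +[1+ m ] ℤ.+ -[1+ n ] ≡ +[1+ k ]
  negated-sum≡ = trans (sym (ℤₚ.neg-distrib-+ -[1+ m ] +[1+ n ])) (cong ℤ.-_ sum≡)

trichotomy : ∀ x → Trichotomy x
trichotomy (u + v ·α) = trichotomy-fuel _ u v ℕₚ.≤-refl

pos?⇒positive : ∀ {x} → T (pos? x) → Positive x
pos?⇒positive {x} pos with trichotomy x
... | inj₁ refl        = ⊥-elim pos
... | inj₂ (inj₁ p)    = p
... | inj₂ (inj₂ p)    = ⊥-elim (pos?-asym x pos (positive⇒pos? p))

-- Order

infix 4 _≺_ _≼_ ∣_∣≺_ ∣_∣≼_

record _≺_ (x y : ℤα) : Set where
  constructor ≺-intro
  field positive-difference : Positive (y ⊖ x)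

record _≼_ (x y : ℤα) : Set where
  constructor ≼-intro
  field nonNegative-difference : NonNegative (y ⊖ x)

∣_∣≺_ ∣_∣≼_ : ℤα → ℤα → Set
∣ x ∣≺ r = x ≺ r × ⊝ x ≺ r
∣ x ∣≼ r = x ≼ r × ⊝ x ≼ r

≼-refl : ∀ {x} → x ≼ x
≼-refl {x} = ≼-intro (eventually-subst (sym (⊝-inverseʳ x)) (nonNegative-fromℕ 0))
  where
  ⊝-inverseʳ : ∀ x → x ⊖ x ≡ 𝟘
  ⊝-inverseʳ = solve-∀ ℤα-ring

≼-≺-trans : ∀ {x y z} → x ≼ y → y ≺ z → x ≺ z
≼-≺-trans {x} {y} {z} (≼-intro x≼y) (≺-intro y≺z) = ≺-intro (eventually-subst (telescope x y z) (positive-⊕ y≺z x≼y))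
  where
  telescope : ∀ x y z → (z ⊖ y) ⊕ (y ⊖ x) ≡ z ⊖ x
  telescope = solve-∀ ℤα-ring

≼-trans : ∀ {x y z} → x ≼ y → y ≼ z → x ≼ z
≼-trans {x} {y} {z} (≼-intro x≼y) (≼-intro y≼z) = ≼-intro (eventually-subst (telescope x y z) (nonNegative-⊕ y≼z x≼y))
  where
  telescope : ∀ x y z → (z ⊖ y) ⊕ (y ⊖ x) ≡ z ⊖ x
  telescope = solve-∀ ℤα-ring

⊕-mono-≼ : ∀ {x y x′ y′} → x ≼ y → x′ ≼ y′ → x ⊕ x′ ≼ y ⊕ y′
⊕-mono-≼ {x} {y} {x′} {y′} (≼-intro x≼y) (≼-intro x′≼y′) =
  ≼-intro (eventually-subst (regroup x y x′ y′) (nonNegative-⊕ x≼y x′≼y′))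
  where
  regroup : ∀ x y x′ y′ → (y ⊖ x) ⊕ (y′ ⊖ x′) ≡ (y ⊕ y′) ⊖ (x ⊕ x′)
  regroup = solve-∀ ℤα-ring

⊗-monoˡ-≼ : ∀ {u x y} → NonNegative u → x ≼ y → u ⊗ x ≼ u ⊗ y
⊗-monoˡ-≼ {u} {x} {y} 0≼u (≼-intro x≼y) = ≼-intro (eventually-subst (distrib u x y) (nonNegative-⊗ 0≼u x≼y))
  where
  distrib : ∀ u x y → u ⊗ (y ⊖ x) ≡ u ⊗ y ⊖ u ⊗ x
  distrib = solve-∀ ℤα-ring

∣∣≼-neg : ∀ {x r} → ∣ x ∣≼ r → ∣ ⊝ x ∣≼ r
∣∣≼-neg {x} {r} (x≼r , -x≼r) = -x≼r , subst (_≼ r) (sym (⊝-involutive x)) x≼r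
  where
  ⊝-involutive : ∀ x → ⊝ (⊝ x) ≡ x
  ⊝-involutive = solve-∀ ℤα-ring

∣∣≼-⊗⊕ : ∀ {u x r c R} → NonNegative u → ∣ x ∣≼ r → ∣ c ∣≼ R → ∣ u ⊗ x ⊕ c ∣≼ u ⊗ r ⊕ R
∣∣≼-⊗⊕ {u} {x} {r} {c} {R} 0≼u (x≼r , -x≼r) (c≼R , -c≼R) =
  ⊕-mono-≼ (⊗-monoˡ-≼ 0≼u x≼r) c≼R ,
  subst (_≼ u ⊗ r ⊕ R) (neg-distrib u x c) (⊕-mono-≼ (⊗-monoˡ-≼ 0≼u -x≼r) -c≼R)
  where
  neg-distrib : ∀ u x c → u ⊗ ⊝ x ⊕ ⊝ c ≡ ⊝ (u ⊗ x ⊕ c)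
  neg-distrib = solve-∀ ℤα-ring

∣∣≼-≺-trans : ∀ {x r R} → ∣ x ∣≼ r → r ≺ R → ∣ x ∣≺ R
∣∣≼-≺-trans (x≼r , -x≼r) r≺R = ≼-≺-trans x≼r r≺R , ≼-≺-trans -x≼r r≺R

∣∣≺-cancel-α^ : ∀ k {x r} → ∣ α ^ k ⊗ x ∣≺ α ^ k ⊗ r → ∣ x ∣≺ r
∣∣≺-cancel-α^ k {x} {r} (x≺r , -x≺r) = cancel x r x≺r , cancel (⊝ x) r (subst (_≺ α ^ k ⊗ r) (neg-⊗ (α ^ k) x) -x≺r)
  where
  neg-⊗ : ∀ a x → ⊝ (a ⊗ x) ≡ a ⊗ ⊝ x
  neg-⊗ = solve-∀ ℤα-ring
  factor : ∀ a x r → a ⊗ r ⊖ a ⊗ x ≡ (r ⊖ x) ⊗ a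
  factor = solve-∀ ℤα-ring
  cancel : ∀ x r → α ^ k ⊗ x ≺ α ^ k ⊗ r → x ≺ r
  cancel x r (≺-intro ax≺ar) = ≺-intro (eventually-cancel k (eventually-subst (factor (α ^ k) x r) ax≺ar))

∣∣≼-weaken : ∀ {x r R} → ∣ x ∣≼ r → r ≼ R → ∣ x ∣≼ R
∣∣≼-weaken (x≼r , -x≼r) r≼R = ≼-trans x≼r r≼R , ≼-trans -x≼r r≼R

<⇒≺ : ∀ {x y} → x < y → x ≺ y
<⇒≺ = ≺-intro ∘ pos?⇒positive

≺⇒≼ : ∀ {x y} → x ≺ y → x ≼ y
≺⇒≼ (≺-intro x≺y) = ≼-intro (positive⇒nonNegative x≺y)

square-mono-≼ : ∀ {x y} → NonNegative x → x ≼ y → x ⊗ x ≼ y ⊗ y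
square-mono-≼ {x} {y} 0≼x (≼-intro x≼y) =
  ≼-intro (eventually-subst (factor x y) (nonNegative-⊗ x≼y (nonNegative-⊕ (nonNegative-⊕ x≼y 0≼x) 0≼x)))
  where
  factor : ∀ x y → (y ⊖ x) ⊗ ((y ⊖ x) ⊕ x ⊕ x) ≡ y ⊗ y ⊖ x ⊗ x
  factor = solve-∀ ℤα-ring

fromℕ-⊗-≺-suc : ∀ t {P} → Positive P → fromℕ t ⊗ P ≺ fromℕ (suc t) ⊗ P
fromℕ-⊗-≺-suc t {P} 0≺P = ≺-intro (eventually-subst (difference (fromℕ t) P) 0≺P)
  where
  difference : ∀ T P → P ≡ (𝟙 ⊕ T) ⊗ P ⊖ T ⊗ P
  difference = solve-∀ ℤα-ring

𝟙≼α^ : ∀ k → 𝟙 ≼ α ^ k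
𝟙≼α^ zero    = ≼-refl
𝟙≼α^ (suc k) = ≼-intro (eventually-subst (regroup α (α ^ k)) (nonNegative-⊕ (nonNegative-⊗ (positive⇒nonNegative (positive-α^ 1)) α^k-1) α-1))
  where
  α^k-1 : NonNegative (α ^ k ⊖ 𝟙)
  α^k-1 = _≼_.nonNegative-difference (𝟙≼α^ k)
  α-1 : NonNegative (α ⊖ 𝟙)
  α-1 = 1 , ℕ-coords 1 0
  regroup : ∀ a y → a ⊗ 𝟙 ⊗ (y ⊖ 𝟙) ⊕ (a ⊖ 𝟙) ≡ a ⊗ y ⊖ 𝟙
  regroup = solve-∀ ℤα-ring

∣sign^⊗∣≼ : ∀ k {X} → NonNegative X → ∣ (⊝ 𝟙) ^ k ⊗ X ∣≼ X
∣sign^⊗∣≼ zero    {X} 0≼X = subst (∣_∣≼ X) (sym (⊗-identityˡ X)) (≼-refl , ≼-intro (eventually-subst (double X) (nonNegative-⊕ 0≼X 0≼X)))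
  where
  double : ∀ X → X ⊕ X ≡ X ⊖ ⊝ X
  double = solve-∀ ℤα-ring
∣sign^⊗∣≼ (suc k) {X} 0≼X = subst (∣_∣≼ X) (negate ((⊝ 𝟙) ^ k) X) (∣∣≼-neg (∣sign^⊗∣≼ k 0≼X))
  where
  negate : ∀ y X → ⊝ (y ⊗ X) ≡ ⊝ 𝟙 ⊗ y ⊗ X
  negate = solve-∀ ℤα-ring

fromℕ-mono-≼ : ∀ {m n} → m ℕ.≤ n → fromℕ m ≼ fromℕ n
fromℕ-mono-≼ {m} {n} m≤n = ≼-intro (eventually-subst (difference m n m≤n) (nonNegative-fromℕ (n ℕ.∸ m)))
  where
  difference : ∀ m n → m ℕ.≤ n → fromℕ (n ℕ.∸ m) ≡ fromℕ n ⊖ fromℕ m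
  difference m n m≤n = begin
    fromℕ (n ℕ.∸ m)                        ≡⟨ add-sub (fromℕ m) (fromℕ (n ℕ.∸ m)) ⟩
    fromℕ m ⊕ fromℕ (n ℕ.∸ m) ⊖ fromℕ m    ≡⟨ cong (_⊖ fromℕ m) (fromℕ-+ m (n ℕ.∸ m)) ⟨
    fromℕ (m ℕ.+ (n ℕ.∸ m)) ⊖ fromℕ m      ≡⟨ cong (λ k → fromℕ k ⊖ fromℕ m) (ℕₚ.m+[n∸m]≡n m≤n) ⟩
    fromℕ n ⊖ fromℕ m                      ∎
    where
    open ≡-Reasoning
    add-sub : ∀ x y → y ≡ x ⊕ y ⊖ x
    add-sub = solve-∀ ℤα-ring

∣∣≺⇒∣∣< : ∀ {x r} → ∣ x ∣≺ r → ∣ x ∣ < r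
∣∣≺⇒∣∣< {x} (≺-intro x≺r , ≺-intro -x≺r) with pos? (⊝ x)
... | true  = positive⇒pos? -x≺r
... | false = positive⇒pos? x≺r

-- Binet's formula

-- 1 − α, the other root of x² = x + 1.
β : ℤα
β = (+ 1) + -[1+ 0 ] ·α

fibonacci-^ : ∀ x → x ⊗ x ≡ x ⊕ 𝟙 → ∀ k → x ^ suc (suc k) ≡ x ^ suc k ⊕ x ^ k
fibonacci-^ x x²≡x+1 k = begin
  x ⊗ (x ⊗ x ^ k)      ≡⟨ ⊗-assoc x x (x ^ k) ⟨
  x ⊗ x ⊗ x ^ k        ≡⟨ cong (_⊗ x ^ k) x²≡x+1 ⟩
  (x ⊕ 𝟙) ⊗ x ^ k      ≡⟨ distrib x (x ^ k) ⟩
  x ⊗ x ^ k ⊕ x ^ k    ∎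
  where
  open ≡-Reasoning
  distrib : ∀ x y → (x ⊕ 𝟙) ⊗ y ≡ x ⊗ y ⊕ y
  distrib = solve-∀ ℤα-ring

binet : ∀ k → fromℕ (fib k) ⊗ √5 ≡ α ^ k ⊖ β ^ k
binet zero          = refl
binet (suc zero)    = refl
binet (suc (suc k)) = begin
  fromℕ (fib (suc k) ℕ.+ fib k) ⊗ √5                      ≡⟨ cong (_⊗ √5) (fromℕ-+ (fib (suc k)) (fib k)) ⟩
  (fromℕ (fib (suc k)) ⊕ fromℕ (fib k)) ⊗ √5              ≡⟨ ⊗-distribʳ-⊕ (fromℕ (fib (suc k))) (fromℕ (fib k)) √5 ⟩
  fromℕ (fib (suc k)) ⊗ √5 ⊕ fromℕ (fib k) ⊗ √5           ≡⟨ cong₂ _⊕_ (binet (suc k)) (binet k) ⟩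
  (α ^ suc k ⊖ β ^ suc k) ⊕ (α ^ k ⊖ β ^ k)              ≡⟨ regroup (α ^ suc k) (β ^ suc k) (α ^ k) (β ^ k) ⟩
  (α ^ suc k ⊕ α ^ k) ⊖ (β ^ suc k ⊕ β ^ k)              ≡⟨ cong₂ _⊖_ (fibonacci-^ α refl k) (fibonacci-^ β refl k) ⟨
  α ^ suc (suc k) ⊖ β ^ suc (suc k)                      ∎
  where
  open ≡-Reasoning
  ⊗-distribʳ-⊕ : ∀ x y z → (x ⊕ y) ⊗ z ≡ x ⊗ z ⊕ y ⊗ z
  ⊗-distribʳ-⊕ = solve-∀ ℤα-ring
  regroup : ∀ a b c d → (a ⊖ b) ⊕ (c ⊖ d) ≡ (a ⊕ c) ⊖ (b ⊕ d)
  regroup = solve-∀ ℤα-ring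

α^⊗β^ : ∀ k → α ^ k ⊗ β ^ k ≡ (⊝ 𝟙) ^ k
α^⊗β^ k = sym (^-distribʳ-⊗ α β k)

-- 2 ^ s ∸ 1, by the recursion t ↦ t + 1 + t of E-step with d = t.
mersenne : ℕ → ℕ
mersenne zero    = 0
mersenne (suc s) = mersenne s ℕ.+ suc (mersenne s)

suc-mersenne : ∀ s → suc (mersenne s) ≡ 2 ℕ.^ s
suc-mersenne zero    = refl
suc-mersenne (suc s) = cong₂ ℕ._+_ (suc-mersenne s) (trans (suc-mersenne s) (sym (ℕₚ.+-identityʳ (2 ℕ.^ s))))

odd≤square : ∀ {k S} → suc k ℕ.≤ S → suc (2 ℕ.* k) ℕ.≤ S ℕ.* S
odd≤square {k} k<S = ℕₚ.≤-trans (subst (suc (2 ℕ.* k) ℕ.≤_) (sym (expand k)) (ℕₚ.m≤m+n _ (k ℕ.* k))) (ℕₚ.*-mono-≤ k<S k<S)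
  where
  open import Data.Nat.Tactic.RingSolver using () renaming (solve-∀ to ℕ-solve-∀)
  expand : ∀ k → suc k ℕ.* suc k ≡ suc (2 ℕ.* k) ℕ.+ k ℕ.* k
  expand = ℕ-solve-∀

-- The estimate

module Estimate (n : ℕ) where

  A B u : ℤα
  A = α ^ n
  B = β ^ n
  u = fromℕ (fib n) ⊗ √5

  E : ℕ → ℤα
  E s = A ⊗ A ⊗ (u ^ s ⊖ A ^ s)

  E-zero : E 0 ≡ 𝟘
  E-zero = annihilate A
    where
    annihilate : ∀ a → a ⊗ a ⊗ (𝟙 ⊖ 𝟙) ≡ 𝟘
    annihilate = solve-∀ ℤα-ring

  E-suc : ∀ s → E (suc s) ≡ u ⊗ E s ⊕ ⊝ (A ⊗ B ⊗ A ^ suc s)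
  E-suc s = begin
    A ⊗ A ⊗ (u ⊗ u ^ s ⊖ A ⊗ A ^ s)                                   ≡⟨ cong (λ v → A ⊗ A ⊗ (v ⊗ u ^ s ⊖ A ⊗ A ^ s)) (binet n) ⟩
    A ⊗ A ⊗ ((A ⊖ B) ⊗ u ^ s ⊖ A ⊗ A ^ s)                             ≡⟨ expand A B (u ^ s) (A ^ s) ⟩
    (A ⊖ B) ⊗ (A ⊗ A ⊗ (u ^ s ⊖ A ^ s)) ⊕ ⊝ (A ⊗ B ⊗ (A ⊗ A ^ s))    ≡⟨ cong (λ v → v ⊗ E s ⊕ ⊝ (A ⊗ B ⊗ A ^ suc s)) (binet n) ⟨
    u ⊗ E s ⊕ ⊝ (A ⊗ B ⊗ A ^ suc s)                                   ∎
    where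
    open ≡-Reasoning
    expand : ∀ a b p q → a ⊗ a ⊗ ((a ⊖ b) ⊗ p ⊖ a ⊗ q) ≡ (a ⊖ b) ⊗ (a ⊗ a ⊗ (p ⊖ q)) ⊕ ⊝ (a ⊗ b ⊗ (a ⊗ q))
    expand = solve-∀ ℤα-ring

  ∣A⊗B⊗∣≼ : ∀ {X} → NonNegative X → ∣ A ⊗ B ⊗ X ∣≼ X
  ∣A⊗B⊗∣≼ {X} 0≼X = subst (λ ε → ∣ ε ⊗ X ∣≼ X) (sym (α^⊗β^ n)) (∣sign^⊗∣≼ n 0≼X)

  nonNegative-A^ : ∀ s → NonNegative (A ^ s)
  nonNegative-A^ = nonNegative-^ (positive⇒nonNegative (positive-α^ n))

  E-step : ∀ s t d → ∣ E s ∣≼ fromℕ t ⊗ A ^ s → fromℕ t ≼ fromℕ d ⊗ (A ⊗ A) →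
           ∣ E (suc s) ∣≼ fromℕ (t ℕ.+ suc d) ⊗ A ^ suc s
  E-step s t d bound (≼-intro t≼dA²) =
    subst (∣_∣≼ t̂′ ⊗ A ^ suc s) (sym (E-suc s))
      (∣∣≼-weaken (∣∣≼-⊗⊕ (nonNegative-⊗ (nonNegative-fromℕ (fib n)) nonNegative-√5) bound
                           (∣∣≼-neg (∣A⊗B⊗∣≼ (nonNegative-A^ (suc s)))))
                  (≼-intro (eventually-subst (sym slack) (nonNegative-⊗ (nonNegative-A^ s) 0≼dA+tB))))
    where
    t̂ d̂ t̂′ : ℤα
    t̂ = fromℕ t
    d̂ = fromℕ d
    t̂′ = fromℕ (t ℕ.+ suc d)
    0≼dA+tB : NonNegative (d̂ ⊗ A ⊕ t̂ ⊗ B)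
    0≼dA+tB = eventually-cancel n (eventually-subst (regroup d̂ t̂ A B)
                (nonNegative-⊕ t≼dA² (_≼_.nonNegative-difference (proj₂ (∣A⊗B⊗∣≼ (nonNegative-fromℕ t))))))
      where
      regroup : ∀ D T a b → (D ⊗ (a ⊗ a) ⊖ T) ⊕ (T ⊖ ⊝ (a ⊗ b ⊗ T)) ≡ (D ⊗ a ⊕ T ⊗ b) ⊗ a
      regroup = solve-∀ ℤα-ring
    slack : t̂′ ⊗ A ^ suc s ⊖ (u ⊗ (t̂ ⊗ A ^ s) ⊕ A ^ suc s) ≡ A ^ s ⊗ (d̂ ⊗ A ⊕ t̂ ⊗ B)
    slack = begin
      t̂′ ⊗ A ^ suc s ⊖ (u ⊗ (t̂ ⊗ A ^ s) ⊕ A ^ suc s)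
        ≡⟨ cong₂ (λ t′ v → t′ ⊗ A ^ suc s ⊖ (v ⊗ (t̂ ⊗ A ^ s) ⊕ A ^ suc s))
                 (trans (fromℕ-+ t (suc d)) (cong (t̂ ⊕_) (fromℕ-+ 1 d))) (binet n) ⟩
      (t̂ ⊕ (𝟙 ⊕ d̂)) ⊗ (A ⊗ A ^ s) ⊖ ((A ⊖ B) ⊗ (t̂ ⊗ A ^ s) ⊕ A ⊗ A ^ s)
        ≡⟨ cancel t̂ d̂ A B (A ^ s) ⟩
      A ^ s ⊗ (d̂ ⊗ A ⊕ t̂ ⊗ B) ∎
      where
      open ≡-Reasoning
      cancel : ∀ T D a b p → (T ⊕ (𝟙 ⊕ D)) ⊗ (a ⊗ p) ⊖ ((a ⊖ b) ⊗ (T ⊗ p) ⊕ a ⊗ p) ≡ p ⊗ (D ⊗ a ⊕ T ⊗ b)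
      cancel = solve-∀ ℤα-ring

  t≼tA² : ∀ t → fromℕ t ≼ fromℕ t ⊗ (A ⊗ A)
  t≼tA² t = subst (_≼ fromℕ t ⊗ (A ⊗ A)) (⊗-identityʳ (fromℕ t))
    (⊗-monoˡ-≼ (nonNegative-fromℕ t) (subst (𝟙 ≼_) (^-distribˡ-+-⊗ α n n) (𝟙≼α^ (n ℕ.+ n))))

  E-bound-mersenne : ∀ s → ∣ E s ∣≼ fromℕ (mersenne s) ⊗ A ^ s
  E-bound-mersenne zero    = subst (∣_∣≼ 𝟘) (sym E-zero) (≼-refl , ≼-refl)
  E-bound-mersenne (suc s) = E-step s (mersenne s) (mersenne s) (E-bound-mersenne s) (t≼tA² (mersenne s))

  module _ (S : ℕ) (S<A : fromℕ S < A) where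

    odd≼A² : ∀ {k} → suc k ℕ.≤ S → fromℕ (suc (2 ℕ.* k)) ≼ fromℕ 1 ⊗ (A ⊗ A)
    odd≼A² k<S = ≼-trans (fromℕ-mono-≼ (odd≤square k<S))
      (subst₂ _≼_ (sym (fromℕ-* S S)) (sym (⊗-identityˡ (A ⊗ A)))
        (square-mono-≼ (nonNegative-fromℕ S) (≺⇒≼ (<⇒≺ {fromℕ S} {A} S<A))))

    E-bound-odd : ∀ k → suc k ℕ.≤ S → ∣ E (suc k) ∣≼ fromℕ (suc (2 ℕ.* k)) ⊗ A ^ suc k
    E-bound-odd zero    _     = E-bound-mersenne 1
    E-bound-odd (suc k) k+1<S = subst (λ t → ∣ E (suc (suc k)) ∣≼ fromℕ t ⊗ A ^ suc (suc k)) (odd-step k)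
      (E-step (suc k) (suc (2 ℕ.* k)) 1 (E-bound-odd k k<S) (odd≼A² k<S))
      where
      open import Data.Nat.Tactic.RingSolver using () renaming (solve-∀ to ℕ-solve-∀)
      k<S : suc k ℕ.≤ S
      k<S = ℕₚ.<⇒≤ k+1<S
      odd-step : ∀ k → suc (2 ℕ.* k) ℕ.+ 2 ≡ suc (2 ℕ.* suc k)
      odd-step = ℕ-solve-∀

  error-bound : ∀ s t → ∣ E s ∣≼ fromℕ t ⊗ A ^ s →
    ∣ u ^ s ⊖ α ^ (n ℕ.* s) ∣ < fromℕ (suc t) ⊗ α^ ((+ n) ℤ.* ((+ s) ℤ.- (+ 2)))
  error-bound s t bound = ∣∣≺⇒∣∣< (∣∣≺-cancel-α^ (n ℕ.+ n)
    (subst₂ ∣_∣≺_ scale-E scale-bound (∣∣≼-≺-trans bound (fromℕ-⊗-≺-suc t 0≺A^s))))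
    where
    Q : ℤα
    Q = α^ ((+ n) ℤ.* ((+ s) ℤ.- (+ 2)))
    A^s≡ : A ^ s ≡ α ^ (n ℕ.* s)
    A^s≡ = ^-*-assoc α n s
    0≺A^s : Positive (A ^ s)
    0≺A^s = subst Positive (sym A^s≡) (positive-α^ (n ℕ.* s))
    scale-E : E s ≡ α ^ (n ℕ.+ n) ⊗ (u ^ s ⊖ α ^ (n ℕ.* s))
    scale-E = cong₂ (λ a² p → a² ⊗ (u ^ s ⊖ p)) (sym (^-distribˡ-+-⊗ α n n)) A^s≡
    scale-bound : fromℕ (suc t) ⊗ A ^ s ≡ α ^ (n ℕ.+ n) ⊗ (fromℕ (suc t) ⊗ Q)
    scale-bound = trans (cong (fromℕ (suc t) ⊗_) (trans A^s≡ (sym (α^-scale n s)))) (swap (fromℕ (suc t)) (α ^ (n ℕ.+ n)) Q)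
      where
      swap : ∀ x y z → x ⊗ (y ⊗ z) ≡ y ⊗ (x ⊗ z)
      swap = solve-∀ ℤα-ring

-- The estimate holds for n = 0 too.
lemma4p6 : (n s : ℕ) → .{{_ : NonZero n}} → .{{_ : NonZero s}} →
    (∣ (fromℕ (fib n) ⊗ √5) ^ s ⊖ α ^ (n ℕ.* s) ∣
        < fromℕ (2 ℕ.^ s) ⊗ α^ ((+ n) ℤ.* ((+ s) ℤ.- (+ 2))))
    × (fromℕ s < α ^ n →
        ∣ (fromℕ (fib n) ⊗ √5) ^ s ⊖ α ^ (n ℕ.* s) ∣
          < fromℕ (2 ℕ.* s) ⊗ α^ ((+ n) ℤ.* ((+ s) ℤ.- (+ 2))))
lemma4p6 n (suc k) =
  subst bound (suc-mersenne (suc k)) (error-bound (suc k) (mersenne (suc k)) (E-bound-mersenne (suc k))) ,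
  λ s<αⁿ → subst bound (double k) (error-bound (suc k) (suc (2 ℕ.* k)) (E-bound-odd (suc k) s<αⁿ k ℕₚ.≤-refl))
  where
  open Estimate n
  open import Data.Nat.Tactic.RingSolver using () renaming (solve-∀ to ℕ-solve-∀)
  bound : ℕ → Set
  bound t = ∣ (fromℕ (fib n) ⊗ √5) ^ suc k ⊖ α ^ (n ℕ.* suc k) ∣ < fromℕ t ⊗ α^ ((+ n) ℤ.* ((+ suc k) ℤ.- (+ 2)))
  double : ∀ k → suc (suc (2 ℕ.* k)) ≡ 2 ℕ.* suc k
  double = ℕ-solve-∀
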